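{- Let $q,w,d$ be positive integers with $d$ odd and let $t=\frac{2w-d+1}{2}$. Let $n\ge w$ and let $\mathcal{H}$ be the hypergraph defined below. Then every matching $\mathcal{M}$ of $\mathcal{H}$ defines an $(n,d,w)_q$-constant weight code $C_{\mathcal{M}}\subseteq J_q(n,w)$ with $|C_{\mathcal{M}}|=|\mathcal{M}|$.
   Context: Let $\Sigma_q=\{0,\dots,q-1\}$ and $J_q(n,w)$ the set of vectors in $\Sigma_q^n$ with exactly $w$ nonzero coordinates. An $(n,d,w)_q$-constant weight code is a subset of $J_q(n,w)$ any two distinct elements of which have Hamming distance at least $d$. For $i\in[n]$ let $V_i=\{(i,a):a\in[q-1]\}$. Let $\mathcal{J}_q(n,w)$ be the set of all sets $\{(i,a_i):i\in S\}$ with $S\subseteq[n]$, $|S|=w$, $a_i\in[q-1]$; for such a set $e$ let $\mathrm{supp}(e)=S$. (The map $\mathbf{x}\mapsto\{(i,x_i):x_i\ne0\}$ is a bijection $J_q(n,w)\to\mathcal{J}_q(n,w)$.) Treat elements of $[n]$ as distinct from the pairs $(i,a)$. Define the hypergraph $\mathcal{H}$ with vertex set the family of all $2t$-element subsets of $(\bigcup_{i=1}^nV_i)\cup[n]$ and edge set $\{\binom{e\cup\mathrm{supp}(e)}{2t}: e\in\mathcal{J}_q(n,w)\}$, where $\binom{X}{k}$ denotes the family of $k$-subsets of $X$. A matching is a set of pairwise disjoint edges. -}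

module Defs where

open import Data.Nat using (ℕ; zero; suc; _+_; _*_; _≤_)
open import Data.Fin using (Fin; toℕ; combine)
open import Data.Fin.Subset using (Subset; _∈_; ∣_∣)
open import Data.Vec using (Vec; lookup)
open import Data.List using (List; length; filter; allFin)
open import Data.List.Relation.Unary.All using (All)
open import Data.List.Relation.Unary.AllPairs using (AllPairs)
open import Data.List.Relation.Unary.Unique.Propositional using (Unique)
open import Data.Product using (_×_; ∃-syntax)
open import Data.Sum using (_⊎_)
open import Data.Empty using (⊥)
open import Relation.Nullary using (¬_; ¬?)
open import Relation.Binary.PropositionalEquality using (_≡_; _≢_)
open import Function.Bundles using (_⇔_)
import Data.Nat as ℕ
import Data.Fin as F

Odd : ℕ → Set
Odd d = ∃[ k ] d ≡ suc (2 * k)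

Word : ℕ → ℕ → Set
Word q n = Vec (Fin q) n

weight : ∀ {q n} → Word q n → ℕ
weight {q} {n} x = length (filter (λ i → ¬? (toℕ (lookup x i) ℕ.≟ 0)) (allFin n))

hamming : ∀ {q n} → Word q n → Word q n → ℕ
hamming {q} {n} x y = length (filter (λ i → ¬? (lookup x i F.≟ lookup y i)) (allFin n))

IsCWCode : (n d w q : ℕ) → List (Word q n) → Set
IsCWCode n d w q C =
  Unique C × All (λ x → weight x ≡ w) C × AllPairs (λ x y → d ≤ hamming x y) C

-- Ground set X = (⋃ V_i) ∪ [n], encoded as Fin n × Fin q ≅ Fin (n * q):
--   point i a (a ≠ 0) stands for the pair (i,a) ∈ V_i,
--   point i 0        stands for the element i ∈ [n].
point : ∀ {n q} → Fin n → Fin q → Fin (n * q)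
point = combine

-- membership of the point (i,a) in e ∪ supp(e), where e corresponds to the word x
InSupportSet : ∀ {q n} → Word q n → Fin n → Fin q → Set
InSupportSet x i a = toℕ (lookup x i) ≢ 0 × (toℕ a ≡ 0 ⊎ a ≡ lookup x i)

-- V is a vertex of H (a 2t-subset of X, i.e. |V| = 2w - d + 1) lying in
-- the edge binom(e ∪ supp(e), 2t) belonging to the word x
InEdge : ∀ {q n} → (w d : ℕ) → Word q n → Subset (n * q) → Set
InEdge {q} {n} w d x V =
  (∣ V ∣ + d ≡ 2 * w + 1) ×
  (∀ (i : Fin n) (a : Fin q) → point i a ∈ V → InSupportSet x i a)

-- A matching of H, given by a list of words x ∈ J_q(n,w) (one label per edge),
-- whose edges are pairwise distinct (as sets of vertices) and pairwise disjoint.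
IsMatching : (n q w d : ℕ) → List (Word q n) → Set
IsMatching n q w d M =
  All (λ x → weight x ≡ w) M ×
  AllPairs (λ x y →
      ¬ (∀ (V : Subset (n * q)) → InEdge w d x V ⇔ InEdge w d y V)
    × (∀ (V : Subset (n * q)) → InEdge w d x V → InEdge w d y V → ⊥)) M

-- The edge of a word x is the family of 2t-subsets of S x = e ∪ supp(e), a set of size 2w.
-- Counting coordinate by coordinate, |S x ∩ S y| + d_H(x,y) = wt(x) + wt(y) = 2w.  Hence if
-- d_H(x,y) < d, then |S x ∩ S y| ≥ 2w − d + 1 = 2t, and any 2t-subset of S x ∩ S y is a
-- vertex common to both edges, contradicting disjointness; and distinct edges come from
-- distinct words.  So the words labelling a matching form the code.  (When 2t ≤ 0 there are
-- no vertices at all, all edges coincide, and distinctness of edges alone gives the claim.)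
module Submission where

open import Defs
open import Data.Bool using (Bool; true; false; _∧_)
open import Data.Empty using (⊥-elim) renaming (⊥ to Empty)
open import Data.Fin using (Fin; zero; suc; toℕ; _↑ˡ_; _↑ʳ_)
import Data.Fin.Properties as Fin
open import Data.Fin.Subset using (Subset; _∈_; _⊆_; ∣_∣; ⊥; ⁅_⁆; _∩_; inside; outside)
open import Data.Fin.Subset.Properties
  using (∣⊥∣≡0; ∣⁅x⁆∣≡1; ∉⊥; ⊥⊆; s⊆s; out⊆; x∈⁅y⁆⇒x≡y; x∈p∩q⁻; ∩-zeroˡ; ∩-zeroʳ; ∩-idem; Empty-unique)
open import Data.List using (List; length; filter)
import Data.List as List
open import Data.List.Relation.Unary.All using (All; []; _∷_)
import Data.List.Relation.Unary.All as All
open import Data.List.Relation.Unary.AllPairs using (AllPairs; []; _∷_)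
import Data.List.Relation.Unary.AllPairs as AllPairs
open import Data.Nat using (ℕ; zero; suc; _+_; _*_; _∸_; _≤_; _<_; _≤?_; s≤s)
import Data.Nat as ℕ
open import Data.Nat.Properties
open import Algebra.Properties.CommutativeSemigroup +-commutativeSemigroup using (interchange)
open import Data.Product using (_×_; _,_; proj₁; proj₂; ∃-syntax)
open import Data.Sum using (_⊎_; inj₁; inj₂)
open import Data.Vec using ([]; _∷_; _++_; lookup; tabulate; here; there)
open import Data.Vec.Properties using (zipWith-++)
open import Function using (_∘_; id)
open import Function.Bundles using (_⇔_; mk⇔)
open import Relation.Binary.PropositionalEquality
open import Relation.Nullary using (¬_; does; yes; no; ¬?; contradiction)
open import Relation.Unary using (Pred; Decidable)

length-filter-tabulate : ∀ {a p} {A : Set a} {P : Pred A p} (P? : Decidable P) {n}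
  (f : Fin n → A) → length (filter P? (List.tabulate f)) ≡ ∣ tabulate (λ i → does (P? (f i))) ∣
length-filter-tabulate P? {zero}  f = refl
length-filter-tabulate P? {suc n} f with does (P? (f zero))
... | true  = cong suc (length-filter-tabulate P? (f ∘ suc))
... | false = length-filter-tabulate P? (f ∘ suc)

∣p++q∣≡∣p∣+∣q∣ : ∀ {m n} (p : Subset m) (q : Subset n) → ∣ p ++ q ∣ ≡ ∣ p ∣ + ∣ q ∣
∣p++q∣≡∣p∣+∣q∣ []            q = refl
∣p++q∣≡∣p∣+∣q∣ (inside  ∷ p) q = cong suc (∣p++q∣≡∣p∣+∣q∣ p q)
∣p++q∣≡∣p∣+∣q∣ (outside ∷ p) q = ∣p++q∣≡∣p∣+∣q∣ p q

x↑ˡ∈p++q⇒x∈p : ∀ {m n} (p : Subset m) {q : Subset n} {x} → x ↑ˡ n ∈ p ++ q → x ∈ p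
x↑ˡ∈p++q⇒x∈p (_ ∷ p) {x = zero}  here       = here
x↑ˡ∈p++q⇒x∈p (_ ∷ p) {x = suc x} (there x∈) = there (x↑ˡ∈p++q⇒x∈p p x∈)

x↑ʳ∈p++q⇒x∈q : ∀ {m n} (p : Subset m) {q : Subset n} {x} → m ↑ʳ x ∈ p ++ q → x ∈ q
x↑ʳ∈p++q⇒x∈q []      x∈         = x∈
x↑ʳ∈p++q⇒x∈q (_ ∷ p) (there x∈) = x↑ʳ∈p++q⇒x∈q p x∈

∣⊥∩p∣≡0 : ∀ {n} (p : Subset n) → ∣ ⊥ ∩ p ∣ ≡ 0
∣⊥∩p∣≡0 {n} p = trans (cong ∣_∣ (∩-zeroˡ p)) (∣⊥∣≡0 n)

∣p∩⊥∣≡0 : ∀ {n} (p : Subset n) → ∣ p ∩ ⊥ ∣ ≡ 0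
∣p∩⊥∣≡0 {n} p = trans (cong ∣_∣ (∩-zeroʳ p)) (∣⊥∣≡0 n)

⁅x⁆∩⁅y⁆≡⊥ : ∀ {n} {x y : Fin n} → x ≢ y → ⁅ x ⁆ ∩ ⁅ y ⁆ ≡ ⊥
⁅x⁆∩⁅y⁆≡⊥ {x = x} {y} x≢y = Empty-unique λ (z , z∈) →
  let z∈⁅x⁆ , z∈⁅y⁆ = x∈p∩q⁻ ⁅ x ⁆ ⁅ y ⁆ z∈
  in x≢y (trans (sym (x∈⁅y⁆⇒x≡y x z∈⁅x⁆)) (x∈⁅y⁆⇒x≡y y z∈⁅y⁆))

∃⊆-of-size : ∀ {n} (p : Subset n) {k} → k ≤ ∣ p ∣ → ∃[ r ] (r ⊆ p × ∣ r ∣ ≡ k)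
∃⊆-of-size {n} p         {zero}  _ = ⊥ , ⊥⊆ , ∣⊥∣≡0 n
∃⊆-of-size (inside  ∷ p) {suc k} (s≤s k≤∣p∣) =
  let r , r⊆p , ∣r∣≡k = ∃⊆-of-size p k≤∣p∣ in inside ∷ r , s⊆s r⊆p , cong suc ∣r∣≡k
∃⊆-of-size (outside ∷ p) {suc k} k≤∣p∣ =
  let r , r⊆p , ∣r∣≡k = ∃⊆-of-size p k≤∣p∣ in outside ∷ r , out⊆ r⊆p , ∣r∣≡k

2w+1∸d≤c : ∀ {c h w d} → c + h ≡ w + w → h < d → 2 * w + 1 ∸ d ≤ c
2w+1∸d≤c {c} {h} {w} {d} c+h≡w+w h<d = begin
  2 * w + 1 ∸ d       ≤⟨ ∸-monoʳ-≤ (2 * w + 1) h<d ⟩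
  2 * w + 1 ∸ suc h   ≡⟨ cong (_∸ suc h) (trans (+-comm (2 * w) 1) (cong (λ z → 1 + (w + z)) (+-identityʳ w))) ⟩
  (w + w) ∸ h         ≡⟨ cong (_∸ h) (sym c+h≡w+w) ⟩
  c + h ∸ h           ≡⟨ m+n∸n≡m c h ⟩
  c                   ∎
  where open ≤-Reasoning

nonzeroᵇ : ∀ {q} → Fin q → Bool
nonzeroᵇ a = does (¬? (toℕ a ℕ.≟ 0))

differᵇ : ∀ {q} → Fin q → Fin q → Bool
differᵇ a b = does (¬? (a Fin.≟ b))

support : ∀ {q n} → Word q n → Subset n
support x = tabulate (nonzeroᵇ ∘ lookup x)

disagreement : ∀ {q n} → Word q n → Word q n → Subset n
disagreement x y = tabulate (λ i → differᵇ (lookup x i) (lookup y i))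

weight≡∣support∣ : ∀ {q n} (x : Word q n) → weight x ≡ ∣ support x ∣
weight≡∣support∣ x = length-filter-tabulate (λ i → ¬? (toℕ (lookup x i) ℕ.≟ 0)) id

hamming≡∣disagreement∣ : ∀ {q n} (x y : Word q n) → hamming x y ≡ ∣ disagreement x y ∣
hamming≡∣disagreement∣ x y = length-filter-tabulate (λ i → ¬? (lookup x i Fin.≟ lookup y i)) id

-- The symbols c with point i c ∈ e ∪ supp(e) when x_i = a: 0 stands for i, a for (i,a).
symbolBlock : ∀ {q} → Fin q → Subset q
symbolBlock zero    = ⊥
symbolBlock (suc a) = inside ∷ ⁅ a ⁆

supportSet : ∀ {q n} → Word q n → Subset (n * q)
supportSet []      = []
supportSet (a ∷ x) = symbolBlock a ++ supportSet x

symbolBlock-sound : ∀ {q} {a c : Fin q} → c ∈ symbolBlock a →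
  toℕ a ≢ 0 × (toℕ c ≡ 0 ⊎ c ≡ a)
symbolBlock-sound {a = zero}  c∈ = contradiction c∈ ∉⊥
symbolBlock-sound {a = suc a} here       = (λ ()) , inj₁ refl
symbolBlock-sound {a = suc a} (there c∈) = (λ ()) , inj₂ (cong suc (x∈⁅y⁆⇒x≡y a c∈))

supportSet-sound : ∀ {q n} (x : Word q n) i c → point i c ∈ supportSet x → InSupportSet x i c
supportSet-sound (a ∷ x) zero    c p = symbolBlock-sound (x↑ˡ∈p++q⇒x∈p (symbolBlock a) p)
supportSet-sound (a ∷ x) (suc i) c p = supportSet-sound x i c (x↑ʳ∈p++q⇒x∈q (symbolBlock a) p)

common : ∀ {q n} → Word q n → Word q n → Subset (n * q)
common x y = supportSet x ∩ supportSet y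

∣symbolBlock∩symbolBlock∣+∣differᵇ∣ : ∀ {q} (a b : Fin q) →
  ∣ symbolBlock a ∩ symbolBlock b ∣ + ∣ differᵇ a b ∷ [] ∣ ≡ ∣ nonzeroᵇ a ∷ [] ∣ + ∣ nonzeroᵇ b ∷ [] ∣
∣symbolBlock∩symbolBlock∣+∣differᵇ∣ {q} zero    zero    = cong (_+ 0) (∣⊥∩p∣≡0 {q} ⊥)
∣symbolBlock∩symbolBlock∣+∣differᵇ∣ {q} zero    (suc b) = cong (_+ 1) (∣⊥∩p∣≡0 (symbolBlock (suc b)))
∣symbolBlock∩symbolBlock∣+∣differᵇ∣ {q} (suc a) zero    = cong (_+ 1) (∣p∩⊥∣≡0 (symbolBlock (suc a)))
∣symbolBlock∩symbolBlock∣+∣differᵇ∣ {suc q} (suc a) (suc b) with a Fin.≟ b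
... | yes refl rewrite ∩-idem ⁅ a ⁆ | ∣⁅x⁆∣≡1 a = refl
... | no a≢b   rewrite ⁅x⁆∩⁅y⁆≡⊥ a≢b | ∣⊥∣≡0 q = refl

∣common∣+∣disagreement∣ : ∀ {q n} (x y : Word q n) →
  ∣ common x y ∣ + ∣ disagreement x y ∣ ≡ ∣ support x ∣ + ∣ support y ∣
∣common∣+∣disagreement∣ []      []      = refl
∣common∣+∣disagreement∣ (a ∷ x) (b ∷ y) = begin
  ∣ common (a ∷ x) (b ∷ y) ∣ + ∣ [a≠b] ++ disagreement x y ∣
    ≡⟨ cong (λ p → ∣ p ∣ + ∣ [a≠b] ++ disagreement x y ∣) (zipWith-++ _∧_ A (supportSet x) B (supportSet y)) ⟩
  ∣ (A ∩ B) ++ common x y ∣ + ∣ [a≠b] ++ disagreement x y ∣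
    ≡⟨ cong₂ _+_ (∣p++q∣≡∣p∣+∣q∣ (A ∩ B) (common x y)) (∣p++q∣≡∣p∣+∣q∣ [a≠b] (disagreement x y)) ⟩
  (∣ A ∩ B ∣ + ∣ common x y ∣) + (∣ [a≠b] ∣ + ∣ disagreement x y ∣)
    ≡⟨ interchange (∣ A ∩ B ∣) (∣ common x y ∣) (∣ [a≠b] ∣) (∣ disagreement x y ∣) ⟩
  (∣ A ∩ B ∣ + ∣ [a≠b] ∣) + (∣ common x y ∣ + ∣ disagreement x y ∣)
    ≡⟨ cong₂ _+_ (∣symbolBlock∩symbolBlock∣+∣differᵇ∣ a b) (∣common∣+∣disagreement∣ x y) ⟩
  (∣ [a≠0] ∣ + ∣ [b≠0] ∣) + (∣ support x ∣ + ∣ support y ∣)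
    ≡⟨ interchange (∣ [a≠0] ∣) (∣ [b≠0] ∣) (∣ support x ∣) (∣ support y ∣) ⟩
  (∣ [a≠0] ∣ + ∣ support x ∣) + (∣ [b≠0] ∣ + ∣ support y ∣)
    ≡⟨ cong₂ _+_ (∣p++q∣≡∣p∣+∣q∣ [a≠0] (support x)) (∣p++q∣≡∣p∣+∣q∣ [b≠0] (support y)) ⟨
  ∣ support (a ∷ x) ∣ + ∣ support (b ∷ y) ∣
    ∎
  where
  open ≡-Reasoning
  A = symbolBlock a
  B = symbolBlock b
  [a≠b] = differᵇ a b ∷ []
  [a≠0] = nonzeroᵇ a ∷ []
  [b≠0] = nonzeroᵇ b ∷ []

∣common∣+hamming≡weight+weight : ∀ {q n} (x y : Word q n) →
  ∣ common x y ∣ + hamming x y ≡ weight x + weight y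
∣common∣+hamming≡weight+weight x y = begin
  ∣ common x y ∣ + hamming x y             ≡⟨ cong (∣ common x y ∣ +_) (hamming≡∣disagreement∣ x y) ⟩
  ∣ common x y ∣ + ∣ disagreement x y ∣    ≡⟨ ∣common∣+∣disagreement∣ x y ⟩
  ∣ support x ∣ + ∣ support y ∣            ≡⟨ cong₂ _+_ (weight≡∣support∣ x) (weight≡∣support∣ y) ⟨
  weight x + weight y                      ∎
  where open ≡-Reasoning

⊆common⇒InEdge : ∀ {q n} w d (x y : Word q n) {V} → V ⊆ common x y →
  ∣ V ∣ + d ≡ 2 * w + 1 → InEdge w d x V × InEdge w d y V
⊆common⇒InEdge w d x y {V} V⊆ size =
    (size , λ i a p → supportSet-sound x i a (proj₁ (both p)))
  , (size , λ i a p → supportSet-sound y i a (proj₂ (both p)))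
  where
  both : ∀ {v} → v ∈ V → v ∈ supportSet x × v ∈ supportSet y
  both v∈V = x∈p∩q⁻ (supportSet x) (supportSet y) (V⊆ v∈V)

InEdge⇒d≤2w+1 : ∀ {q n} {w d} {x : Word q n} {V} → InEdge w d x V → d ≤ 2 * w + 1
InEdge⇒d≤2w+1 {d = d} {V = V} (size , _) = ≤-trans (m≤n+m d ∣ V ∣) (≤-reflexive size)

hamming<d⇒sharedVertex : ∀ {q n} w d (x y : Word q n) → weight x ≡ w → weight y ≡ w →
  hamming x y < d → d ≤ 2 * w + 1 → ∃[ V ] (InEdge w d x V × InEdge w d y V)
hamming<d⇒sharedVertex w d x y wx wy h<d d≤2w+1 =
  let k≤∣common∣ = 2w+1∸d≤c {w = w} (trans (∣common∣+hamming≡weight+weight x y) (cong₂ _+_ wx wy)) h<d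
      V , V⊆ , ∣V∣≡k = ∃⊆-of-size (common x y) k≤∣common∣
  in V , ⊆common⇒InEdge w d x y V⊆ (trans (cong (_+ d) ∣V∣≡k) (m∸n+n≡m d≤2w+1))

matched⇒d≤hamming : ∀ {q n} w d (x y : Word q n) → weight x ≡ w → weight y ≡ w →
  ¬ (∀ V → InEdge w d x V ⇔ InEdge w d y V) →
  (∀ V → InEdge w d x V → InEdge w d y V → Empty) →
  d ≤ hamming x y
matched⇒d≤hamming w d x y wx wy distinct disjoint with d ≤? hamming x y | d ≤? 2 * w + 1
... | yes d≤h | _          = d≤h
... | no  d≰h | yes d≤2w+1 =
  let V , x∋V , y∋V = hamming<d⇒sharedVertex w d x y wx wy (≰⇒> d≰h) d≤2w+1
  in ⊥-elim (disjoint V x∋V y∋V)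
... | no  _   | no d≰2w+1  = ⊥-elim (distinct λ V → mk⇔ (⊥-elim ∘ noEdge x) (⊥-elim ∘ noEdge y))
  where
  noEdge : ∀ z {V} → ¬ InEdge w d z V
  noEdge z {V} = d≰2w+1 ∘ InEdge⇒d≤2w+1 {w = w} {d} {z} {V}

distinctEdges⇒≢ : ∀ {q n} {w d} {x y : Word q n} →
  ¬ (∀ V → InEdge w d x V ⇔ InEdge w d y V) → x ≢ y
distinctEdges⇒≢ distinct refl = distinct λ _ → mk⇔ id id

allPairs-mapWithAll : ∀ {a p r s} {A : Set a} {P : Pred A p} {R : A → A → Set r} {S : A → A → Set s} →
  (∀ {x y} → P x → P y → R x y → S x y) → ∀ {xs} → All P xs → AllPairs R xs → AllPairs S xs
allPairs-mapWithAll f []         []         = []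
allPairs-mapWithAll f (px ∷ pxs) (rx ∷ rxs) =
  All.zipWith (λ (py , r) → f px py r) (pxs , rx) ∷ allPairs-mapWithAll f pxs rxs

lemma3p1 : (q w d : ℕ) → 1 ≤ q → 1 ≤ w → 1 ≤ d → Odd d →
    (n : ℕ) → w ≤ n →
    (M : List (Word q n)) → IsMatching n q w d M →
    ∃[ C ] (IsCWCode n d w q C × length C ≡ length M)
lemma3p1 q w d _ _ _ _ n _ M (weights , matched) =
  M , (unique , weights , distances) , refl
  where
  unique : AllPairs _≢_ M
  unique = AllPairs.map (distinctEdges⇒≢ {w = w} {d} ∘ proj₁) matched

  distances : AllPairs (λ x y → d ≤ hamming x y) M
  distances = allPairs-mapWithAll
    (λ {x} {y} wx wy (distinct , disjoint) → matched⇒d≤hamming w d x y wx wy distinct disjoint)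
    weights matched
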